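{- Let $q$ be a prime power, $d\ge 2$ an integer and $f=x^d\in\mathbb{F}_q[x]$. Then \[\deg(S_f)\le \max\Big(\gcd(d,q-1),\ 1+\gcd(d-1,q-1),\ \big\lfloor \tfrac12+\sqrt{q-1}\big\rfloor\Big).\] In particular, if $\lfloor \frac12+\sqrt{q-1}\rfloor\le \max(\gcd(d,q-1),1+\gcd(d-1,q-1))$, then $\deg(S_f)=\max(\gcd(d,q-1),1+\gcd(d-1,q-1))$.
   Context: $\mathrm{PG}(2,q)$ is the projective plane over $\mathbb{F}_q$. For $f\in\mathbb{F}_q[x]$, $S_f=\{(x,f(x),1):x\in\mathbb{F}_q\}\cup\{(0,1,0)\}$. For a set $D$ of $q+1$ points, $u_i(D)$ is the number of lines of $\mathrm{PG}(2,q)$ containing exactly $i$ points of $D$, and $\deg(D)$ is the largest $i$ with $u_i(D)\neq 0$. -}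

module Defs where

open import Data.Nat as ℕ using (ℕ; zero; suc; _∸_; _⊔_; _≤?_)
open import Data.Fin using (Fin)
open import Data.List using (List; []; _∷_; map; filter; length; foldr; concatMap; upTo; allFin)
open import Data.Product using (Σ; _×_; _,_)
open import Data.Product.Properties using (≡-dec)
open import Relation.Nullary using (¬_; Dec)
open import Relation.Nullary.Decidable using (¬?)
open import Relation.Binary.PropositionalEquality using (_≡_)
open import Function.Bundles using (_↔_; Inverse)
open import Algebra.Structures using (IsCommutativeRing)

-- Such a structure exists iff q is a prime power, and it
-- is then unique up to isomorphism (it is F_q).
record FiniteField (q : ℕ) : Set₁ where
  infixl 7 _*_
  infixl 6 _+_
  field
    Carrier  : Set
    _+_ _*_  : Carrier → Carrier → Carrier
    -_       : Carrier → Carrier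
    0# 1#    : Carrier
    isCommutativeRing : IsCommutativeRing _≡_ _+_ _*_ -_ 0# 1#
    0≢1      : ¬ (0# ≡ 1#)
    inverse  : ∀ x → ¬ (x ≡ 0#) → Σ Carrier (λ y → x * y ≡ 1#)
    _≟_      : (x y : Carrier) → Dec (x ≡ y)
    enum     : Fin q ↔ Carrier

maxList : List ℕ → ℕ
maxList = foldr _⊔_ 0

module _ {q : ℕ} (F : FiniteField q) where
  open FiniteField F

  elements : List Carrier
  elements = map (Inverse.to enum) (allFin q)

  pow : Carrier → ℕ → Carrier
  pow x zero    = 1#
  pow x (suc n) = x * pow x n

  -- homogeneous coordinates (x,y,z) of points and [a,b,c] of lines of PG(2,q)
  Triple : Set
  Triple = Carrier × Carrier × Carrier

  _≟T_ : (s t : Triple) → Dec (s ≡ t)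
  _≟T_ = ≡-dec _≟_ (≡-dec _≟_ _≟_)

  form : Triple → Triple → Carrier
  form (a , b , c) (x , y , z) = a * x + b * y + c * z

  incident? : (ℓ : Triple) (p : Triple) → Dec (form ℓ p ≡ 0#)
  incident? ℓ p = form ℓ p ≟ 0#

  -- all lines of PG(2,q), each given by all its (q-1) nonzero coordinate vectors
  lineCoords : List Triple
  lineCoords = filter (λ t → ¬? (t ≟T (0# , 0# , 0#)))
    (concatMap (λ a → concatMap (λ b → map (λ c → (a , b , c)) elements) elements) elements)

  -- a point set D of PG(2,q) given by a list of pairwise non-proportional
  -- representatives; number of points of D on line ℓ
  onLine : List Triple → Triple → ℕ
  onLine D ℓ = length (filter (incident? ℓ) D)

  deg : List Triple → ℕ
  deg D = maxList (map (onLine D) lineCoords)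

  S : (Carrier → Carrier) → List Triple
  S f = (0# , 1# , 0#) ∷ map (λ x → (x , f x , 1#)) elements

-- ⌊ 1/2 + √n ⌋ :  for k ≥ 1,  k ≤ 1/2 + √n  iff  (2k-1)² ≤ 4n,
-- so it is the largest k ∈ {0,…,n+1} with (2k ∸ 1)² ≤ 4n  (k = 0 always qualifies).
floorHalfPlusSqrt : ℕ → ℕ
floorHalfPlusSqrt n =
  maxList (filter (λ k → ((2 ℕ.* k ∸ 1) ℕ.* (2 ℕ.* k ∸ 1)) ≤? 4 ℕ.* n) (upTo (suc (suc n))))

{-# OPTIONS --safe #-}
module Submission where

-- A line [a, b, c] with b ≢ 0 misses (0, 1, 0) and meets S_f, f = xᵈ, in the points (x, xᵈ, 1) with
-- E(x) = a x + b xᵈ + c = 0; a line with b = 0 passes through (0, 1, 0) and meets at most one further point.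
-- If a = 0 and c ≢ 0, the solutions have equal d-th powers, so their ratios are roots of x^gcd(d, q − 1) − 1 by
-- Fermat and Bézout, and there are at most gcd(d, q − 1) of them. If c = 0, they are 0 and the solutions of
-- a + b x^(d − 1) = 0, at most 1 + gcd(d − 1, q − 1). If a, c ≢ 0, then tᵈ E(x) − E(t x) = a (tᵈ − t) x + c (tᵈ − 1)
-- shows that no t ≢ 1 maps two distinct solutions to solutions; hence the N (N − 1) ratios of distinct solutions
-- are distinct elements other than 0 and 1, and N (N − 1) ≤ q − 2, i.e. N ≤ ⌊1/2 + √(q − 1)⌋.
-- Conversely, y = z meets S_f in the d-th roots of unity and y = x in 0 and the (d − 1)-th roots of unity. For
-- m ∣ q − 1 there are at least m m-th roots of unity, since every other element is a root of
-- x (1 + xᵐ + x²ᵐ + ⋯ + x^(q − 1 − m)), a polynomial of degree q − m.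

open import Defs
open import Data.Nat as ℕ using (ℕ; zero; suc; _≤_; _<_; _∸_; _⊔_; z≤n; s≤s)
open import Data.Nat.Properties as ℕ using (≤-refl; ≤-trans; ⊔-lub; m≤n⇒m≤n⊔o; m≤n⇒m≤o⊔n)
open import Data.Nat.Divisibility using (_∣_; divides)
open import Data.Nat.GCD using (gcd; gcd-GCD; gcd[m,n]≢0; gcd[m,n]∣m; gcd[m,n]∣n; module Bézout)
import Data.Nat.Solver
open import Data.Product using (_×_; _,_; proj₁; proj₂)
open import Data.Sum using (_⊎_; inj₁; inj₂)
open import Data.List using (List; []; _∷_; [_]; map; filter; length; foldr; concatMap; allFin; replicate; _++_)
open import Data.List.Properties
  using (length-++; length-map; length-tabulate; length-replicate; ++-identityʳ; foldr-preservesᵇ; foldr-preservesᵒ)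
open import Data.List.Membership.Propositional using (_∈_; find; lose)
open import Data.List.Membership.Propositional.Properties
  using (∈-filter⁺; ∈-filter⁻; ∈-∃++; ∈-++⁻; ∈-++⁺ˡ; ∈-++⁺ʳ; ∈-upTo⁺; ∈-map⁺; ∈-map⁻; ∈-allFin;
         ∈-concatMap⁺; ∈-concatMap⁻)
open import Data.List.Membership.Propositional.Properties.WithK using (unique∧set⇒bag)
open import Data.List.Relation.Unary.Any as Any using (here; there)
open import Data.List.Relation.Unary.All as All using (All; []; _∷_)
open import Data.List.Relation.Unary.All.Properties as Allₚ using (all-filter)
open import Data.List.Relation.Unary.Unique.Propositional using (Unique; []; _∷_)
open import Data.List.Relation.Unary.Unique.Propositional.Properties as Unique using ()
open import Data.List.Relation.Binary.Subset.Propositional using (_⊆_)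
open import Data.List.Relation.Binary.Disjoint.Propositional using (Disjoint)
open import Data.List.Relation.Binary.Permutation.Propositional using (_↭_; ↭⇒↭ₛ)
open import Data.List.Relation.Binary.BagAndSetEquality using (∼bag⇒↭)
open import Function using (id; _∘_; Inverse; Injection; mk⇔)
open import Function.Properties.Inverse using (Inverse⇒Injection)
open import Relation.Nullary using (¬?; yes; no; contradiction)
open import Relation.Unary using (Pred; Decidable)
open import Relation.Unary.Properties using (∁?)
open import Relation.Binary.Definitions using (DecidableEquality)
open import Relation.Binary.PropositionalEquality as Eq
  using (_≡_; _≢_; refl; sym; trans; cong; cong₂; subst; module ≡-Reasoning)
open import Algebra.Bundles using (Semiring; CommutativeRing)

module _ {a} {A : Set a} where

  unique-⊆⇒length≤ : {xs ys : List A} → Unique xs → xs ⊆ ys → length xs ≤ length ys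
  unique-⊆⇒length≤ {[]} _ _ = z≤n
  unique-⊆⇒length≤ {x ∷ xs} {ys} (x∉xs ∷ xs!) xs⊆ys with ∈-∃++ (xs⊆ys (here refl))
  ... | as , bs , refl = begin
    suc (length xs)               ≤⟨ s≤s (unique-⊆⇒length≤ xs! xs⊆as++bs) ⟩
    suc (length (as ++ bs))       ≡⟨ cong suc (length-++ as) ⟩
    suc (length as ℕ.+ length bs) ≡⟨ ℕ.+-suc (length as) (length bs) ⟨
    length as ℕ.+ length (x ∷ bs) ≡⟨ length-++ as ⟨
    length (as ++ x ∷ bs)         ∎
    where
    open ℕ.≤-Reasoning
    xs⊆as++bs : xs ⊆ as ++ bs
    xs⊆as++bs y∈xs with ∈-++⁻ as (xs⊆ys (there y∈xs))
    ... | inj₁ y∈as          = ∈-++⁺ˡ y∈as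
    ... | inj₂ (here refl)   = contradiction refl (All.lookup x∉xs y∈xs)
    ... | inj₂ (there y∈bs)  = ∈-++⁺ʳ as y∈bs

  unique-allEqual⇒length≤1 : {xs : List A} → Unique xs → (∀ {x y} → x ∈ xs → y ∈ xs → x ≡ y) → length xs ≤ 1
  unique-allEqual⇒length≤1 {[]}     _   _        = z≤n
  unique-allEqual⇒length≤1 {x ∷ xs} xs! allEqual =
    unique-⊆⇒length≤ {ys = [ x ]} xs! (λ y∈ → here (allEqual y∈ (here refl)))

  module _ {p} {P : Pred A p} (P? : Decidable P) where

    length-filter+length-filter-∁ : ∀ xs → length (filter P? xs) ℕ.+ length (filter (∁? P?) xs) ≡ length xs
    length-filter+length-filter-∁ [] = refl
    length-filter+length-filter-∁ (x ∷ xs) with P? x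
    ... | yes _ = cong suc (length-filter+length-filter-∁ xs)
    ... | no  _ = trans (ℕ.+-suc _ _) (cong suc (length-filter+length-filter-∁ xs))

module _ {a b p} {A : Set a} {B : Set b} {P : Pred B p} (P? : Decidable P) (g : A → B) where

  length-filter-map : ∀ xs → length (filter P? (map g xs)) ≡ length (filter (P? ∘ g) xs)
  length-filter-map []       = refl
  length-filter-map (x ∷ xs) with P? (g x)
  ... | yes _ = cong suc (length-filter-map xs)
  ... | no  _ = length-filter-map xs

module _ {a b} {A : Set a} {B : Set b} (f : A → List B) where

  concatMap-unique : ∀ {xs} → Unique xs → (∀ {x} → x ∈ xs → Unique (f x)) →
                     (∀ {x y z} → x ∈ xs → y ∈ xs → z ∈ f x → z ∈ f y → x ≡ y) → Unique (concatMap f xs)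
  concatMap-unique {[]}     _            _   _        = []
  concatMap-unique {x ∷ xs} (x∉xs ∷ xs!) fs! disjoint =
    Unique.++⁺ (fs! (here refl)) (concatMap-unique xs! (fs! ∘ there) (λ p r → disjoint (there p) (there r))) fx#rest
    where
    fx#rest : Disjoint (f x) (concatMap f xs)
    fx#rest (z∈fx , z∈rest) with find (∈-concatMap⁻ f z∈rest)
    ... | y , y∈xs , z∈fy = All.lookup x∉xs y∈xs (disjoint (here refl) (there y∈xs) z∈fx z∈fy)

  length-concatMap≥ : ∀ {k xs} → All (λ x → k ≤ length (f x)) xs → length xs ℕ.* k ≤ length (concatMap f xs)
  length-concatMap≥ []                           = z≤n
  length-concatMap≥ {xs = x ∷ xs} (k≤fx ∷ k≤fxs) =
    ≤-trans (ℕ.+-mono-≤ k≤fx (length-concatMap≥ k≤fxs)) (ℕ.≤-reflexive (sym (length-++ (f x))))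

module _ {a} {A : Set a} (_≟_ : DecidableEquality A) where

  length-filter-≢ : ∀ {x} {xs : List A} → Unique xs → x ∈ xs → suc (length (filter (∁? (_≟ x)) xs)) ≡ length xs
  length-filter-≢ {x} {xs} xs! x∈xs = begin
    suc (length others)                         ≡⟨ cong (ℕ._+ length others) length-copies ⟨
    length (filter (_≟ x) xs) ℕ.+ length others ≡⟨ length-filter+length-filter-∁ (_≟ x) xs ⟩
    length xs                                   ∎
    where
    open ≡-Reasoning
    others = filter (∁? (_≟ x)) xs
    copies⊆[x] : filter (_≟ x) xs ⊆ [ x ]
    copies⊆[x] y∈copies = here (proj₂ (∈-filter⁻ (_≟ x) {xs = xs} y∈copies))
    [x]⊆copies : [ x ] ⊆ filter (_≟ x) xs
    [x]⊆copies (here refl) = ∈-filter⁺ (_≟ x) x∈xs refl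
    length-copies : length (filter (_≟ x) xs) ≡ 1
    length-copies = ℕ.≤-antisym (unique-⊆⇒length≤ (Unique.filter⁺ (_≟ x) xs!) copies⊆[x])
                                (unique-⊆⇒length≤ ([] ∷ []) [x]⊆copies)

maxList-≤ : ∀ {m} {ns : List ℕ} → All (_≤ m) ns → maxList ns ≤ m
maxList-≤ = foldr-preservesᵇ ⊔-lub z≤n

≤-maxList : ∀ {n} {ns : List ℕ} → n ∈ ns → n ≤ maxList ns
≤-maxList {n} {ns} n∈ns = foldr-preservesᵒ ≤-⊔ 0 ns (inj₂ (Any.map (λ { refl → ≤-refl }) n∈ns))
  where
  ≤-⊔ : ∀ k l → n ≤ k ⊎ n ≤ l → n ≤ k ⊔ l
  ≤-⊔ k l (inj₁ n≤k) = m≤n⇒m≤n⊔o l n≤k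
  ≤-⊔ k l (inj₂ n≤l) = m≤n⇒m≤o⊔n k n≤l

n*[n∸1]<m⇒n≤floorHalfPlusSqrt : ∀ n m → n ℕ.* (n ∸ 1) < m → n ≤ floorHalfPlusSqrt m
n*[n∸1]<m⇒n≤floorHalfPlusSqrt zero    m _         = z≤n
n*[n∸1]<m⇒n≤floorHalfPlusSqrt (suc k) m [k+1]k<m =
  ≤-maxList (∈-filter⁺ square≤4m? (∈-upTo⁺ (s≤s (s≤s k≤m))) square≤4m)
  where
  square≤4m? = λ j → (2 ℕ.* j ∸ 1) ℕ.* (2 ℕ.* j ∸ 1) ℕ.≤? 4 ℕ.* m
  k≤m : k ≤ m
  k≤m = ≤-trans (ℕ.m≤m+n k (k ℕ.* k)) (ℕ.<⇒≤ [k+1]k<m)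
  odd-square : suc (2 ℕ.* k) ℕ.* suc (2 ℕ.* k) ℕ.+ 3 ≡ 4 ℕ.* suc (suc k ℕ.* k)
  odd-square = solve 1 (λ k → (con 1 :+ con 2 :* k) :* (con 1 :+ con 2 :* k) :+ con 3
                              := con 4 :* (con 1 :+ (con 1 :+ k) :* k)) refl k
    where open Data.Nat.Solver.+-*-Solver
  square≤4m : (2 ℕ.* suc k ∸ 1) ℕ.* (2 ℕ.* suc k ∸ 1) ≤ 4 ℕ.* m
  square≤4m = subst (λ o → o ℕ.* o ≤ 4 ℕ.* m) (cong (_∸ 1) (sym (ℕ.*-suc 2 k)))
    (≤-trans (ℕ.m≤m+n _ 3) (≤-trans (ℕ.≤-reflexive odd-square) (ℕ.*-monoʳ-≤ 4 [k+1]k<m)))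

module _ {c ℓ} (R : Semiring c ℓ) where
  open Semiring R using (_≈_; _*_; 1#; setoid; *-identityˡ; *-identityʳ; *-congˡ)
    renaming (refl to ≈-refl; trans to ≈-trans)
  open import Algebra.Properties.Semiring.Exp R using (_^_; ^-homo-*; ^-assocʳ; ^-congˡ)
  open import Relation.Binary.Reasoning.Setoid setoid

  1^n≈1 : ∀ n → 1# ^ n ≈ 1#
  1^n≈1 zero    = ≈-refl
  1^n≈1 (suc n) = ≈-trans (*-identityˡ _) (1^n≈1 n)

  x^n≈1⇒x^[k*n]≈1 : ∀ {x} n k → x ^ n ≈ 1# → x ^ (k ℕ.* n) ≈ 1#
  x^n≈1⇒x^[k*n]≈1 {x} n k x^n≈1 = begin
    x ^ (k ℕ.* n) ≡⟨ Eq.cong (x ^_) (ℕ.*-comm k n) ⟩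
    x ^ (n ℕ.* k) ≈⟨ ^-assocʳ x n k ⟨
    (x ^ n) ^ k   ≈⟨ ^-congˡ k x^n≈1 ⟩
    1# ^ k        ≈⟨ 1^n≈1 k ⟩
    1#            ∎

  x^[m+n]≈1⇒x^m≈1 : ∀ {x} m n → x ^ n ≈ 1# → x ^ (m ℕ.+ n) ≈ 1# → x ^ m ≈ 1#
  x^[m+n]≈1⇒x^m≈1 {x} m n x^n≈1 x^[m+n]≈1 = begin
    x ^ m            ≈⟨ *-identityʳ (x ^ m) ⟨
    x ^ m * 1#       ≈⟨ *-congˡ x^n≈1 ⟨
    x ^ m * x ^ n    ≈⟨ ^-homo-* x m n ⟨
    x ^ (m ℕ.+ n)    ≈⟨ x^[m+n]≈1 ⟩
    1#               ∎

  x^m≈1⇒x^n≈1⇒x^gcd≈1 : ∀ {x} m n → x ^ m ≈ 1# → x ^ n ≈ 1# → x ^ gcd m n ≈ 1#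
  x^m≈1⇒x^n≈1⇒x^gcd≈1 {x} m n x^m≈1 x^n≈1 with Bézout.identity (gcd-GCD m n)
  ... | Bézout.+- a b g+bn≡am = x^[m+n]≈1⇒x^m≈1 (gcd m n) (b ℕ.* n) (x^n≈1⇒x^[k*n]≈1 n b x^n≈1)
          (Eq.subst (λ e → x ^ e ≈ 1#) (Eq.sym g+bn≡am) (x^n≈1⇒x^[k*n]≈1 m a x^m≈1))
  ... | Bézout.-+ a b g+am≡bn = x^[m+n]≈1⇒x^m≈1 (gcd m n) (a ℕ.* m) (x^n≈1⇒x^[k*n]≈1 m a x^m≈1)
          (Eq.subst (λ e → x ^ e ≈ 1#) (Eq.sym g+am≡bn) (x^n≈1⇒x^[k*n]≈1 n b x^n≈1))

module FiniteFieldProperties {q : ℕ} (F : FiniteField q) where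
  open FiniteField F

  commutativeRing : CommutativeRing _ _
  commutativeRing = record { isCommutativeRing = isCommutativeRing }

  open CommutativeRing commutativeRing public
    using (commutativeSemiring; semiring; *-isCommutativeMonoid; +-identityˡ; +-identityʳ; +-assoc;
           *-identityˡ; *-identityʳ; *-assoc; *-comm; zeroˡ; zeroʳ; -‿inverseˡ; -‿inverseʳ)
  open import Algebra.Properties.Ring (CommutativeRing.ring commutativeRing) public using (+-cancelˡ; +-cancelʳ; x∙y⁻¹≈ε⇒x≈y)
  open import Algebra.Properties.CommutativeSemiring.Exp commutativeSemiring public using (_^_; ^-distrib-*; ^-assocʳ)
  open import Algebra.Solver.Ring.NaturalCoefficients.Default commutativeSemiring using (solve; _:=_; _:+_; _:*_; con)
  open ≡-Reasoning

  1≢0 : 1# ≢ 0#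
  1≢0 1≡0 = 0≢1 (sym 1≡0)

  -- 0 ⁻¹ = 0 is a junk value.
  _⁻¹ : Carrier → Carrier
  x ⁻¹ with x ≟ 0#
  ... | yes _   = 0#
  ... | no  x≢0 = proj₁ (inverse x x≢0)

  x*x⁻¹≡1 : ∀ {x} → x ≢ 0# → x * x ⁻¹ ≡ 1#
  x*x⁻¹≡1 {x} x≢0 with x ≟ 0#
  ... | yes x≡0 = contradiction x≡0 x≢0
  ... | no  x≢0 = proj₂ (inverse x x≢0)

  *-cancelˡ-nonZero : ∀ {x y z} → x ≢ 0# → x * y ≡ x * z → y ≡ z
  *-cancelˡ-nonZero {x} {y} {z} x≢0 xy≡xz = begin
    y                ≡⟨ *-identityˡ y ⟨
    1# * y           ≡⟨ cong (_* y) (x*x⁻¹≡1 x≢0) ⟨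
    x * x ⁻¹ * y     ≡⟨ solve 3 (λ x x⁻ y → x :* x⁻ :* y := x⁻ :* (x :* y)) refl x (x ⁻¹) y ⟩
    x ⁻¹ * (x * y)   ≡⟨ cong (x ⁻¹ *_) xy≡xz ⟩
    x ⁻¹ * (x * z)   ≡⟨ solve 3 (λ x x⁻ z → x⁻ :* (x :* z) := x :* x⁻ :* z) refl x (x ⁻¹) z ⟩
    x * x ⁻¹ * z     ≡⟨ cong (_* z) (x*x⁻¹≡1 x≢0) ⟩
    1# * z           ≡⟨ *-identityˡ z ⟩
    z                ∎

  *-cancelʳ-nonZero : ∀ {x y z} → x ≢ 0# → y * x ≡ z * x → y ≡ z
  *-cancelʳ-nonZero {x} {y} {z} x≢0 yx≡zx = *-cancelˡ-nonZero x≢0 (trans (*-comm x y) (trans yx≡zx (*-comm z x)))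

  x*y≡0⇒y≡0 : ∀ {x y} → x ≢ 0# → x * y ≡ 0# → y ≡ 0#
  x*y≡0⇒y≡0 {x} x≢0 xy≡0 = *-cancelˡ-nonZero x≢0 (trans xy≡0 (sym (zeroʳ x)))

  *-nonZero : ∀ {x y} → x ≢ 0# → y ≢ 0# → x * y ≢ 0#
  *-nonZero x≢0 y≢0 xy≡0 = y≢0 (x*y≡0⇒y≡0 x≢0 xy≡0)

  ⁻¹-nonZero : ∀ {x} → x ≢ 0# → x ⁻¹ ≢ 0#
  ⁻¹-nonZero {x} x≢0 x⁻¹≡0 = 1≢0 (trans (sym (x*x⁻¹≡1 x≢0)) (trans (cong (x *_) x⁻¹≡0) (zeroʳ x)))

  x*y⁻¹*y≡x : ∀ {x y} → y ≢ 0# → x * y ⁻¹ * y ≡ x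
  x*y⁻¹*y≡x {x} {y} y≢0 = begin
    x * y ⁻¹ * y     ≡⟨ *-assoc x (y ⁻¹) y ⟩
    x * (y ⁻¹ * y)   ≡⟨ cong (x *_) (trans (*-comm (y ⁻¹) y) (x*x⁻¹≡1 y≢0)) ⟩
    x * 1#           ≡⟨ *-identityʳ x ⟩
    x                ∎

  u*x+u′*y≡u′*x+u*y⇒u≡u′ : ∀ {u u′ x y} → x ≢ y → u * x + u′ * y ≡ u′ * x + u * y → u ≡ u′
  u*x+u′*y≡u′*x+u*y⇒u≡u′ {u} {u′} {x} {y} x≢y cross with (u + - u′) ≟ 0#
  ... | yes w≡0 = x∙y⁻¹≈ε⇒x≈y u u′ w≡0
  ... | no  w≢0 = contradiction (*-cancelˡ-nonZero w≢0 (+-cancelʳ (u′ * x + u′ * y) _ _ (begin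
    w * x + (u′ * x + u′ * y)   ≡⟨ solve 4 (λ w u′ x y → w :* x :+ (u′ :* x :+ u′ :* y) := (w :+ u′) :* x :+ u′ :* y)
                                           refl w u′ x y ⟩
    (w + u′) * x + u′ * y       ≡⟨ cong (λ v → v * x + u′ * y) w+u′≡u ⟩
    u * x + u′ * y              ≡⟨ cross ⟩
    u′ * x + u * y              ≡⟨ cong (λ v → u′ * x + v * y) w+u′≡u ⟨
    u′ * x + (w + u′) * y       ≡⟨ solve 4 (λ w u′ x y → u′ :* x :+ (w :+ u′) :* y := w :* y :+ (u′ :* x :+ u′ :* y))
                                           refl w u′ x y ⟩
    w * y + (u′ * x + u′ * y)   ∎))) x≢y
    where
    w = u + - u′
    w+u′≡u : w + u′ ≡ u
    w+u′≡u = trans (+-assoc u (- u′) u′) (trans (cong (u +_) (-‿inverseˡ u′)) (+-identityʳ u))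

  affine-agree : ∀ {u v u′ v′ x y} → x ≢ y →
                 u * x + v ≡ u′ * x + v′ → u * y + v ≡ u′ * y + v′ → u ≡ u′ × v ≡ v′
  affine-agree {u} {v} {u′} {v′} {x} {y} x≢y at-x at-y =
    u≡u′ , +-cancelˡ (u′ * x) v v′ (trans (cong (λ w → w * x + v) (sym u≡u′)) at-x)
    where
    u≡u′ : u ≡ u′
    u≡u′ = u*x+u′*y≡u′*x+u*y⇒u≡u′ x≢y (+-cancelʳ (v + v′) _ _ (begin
      u * x + u′ * y + (v + v′)    ≡⟨ solve 6 (λ u u′ x y v v′ → u :* x :+ u′ :* y :+ (v :+ v′)
                                                             := (u :* x :+ v) :+ (u′ :* y :+ v′)) refl u u′ x y v v′ ⟩
      (u * x + v) + (u′ * y + v′)  ≡⟨ cong₂ _+_ at-x (sym at-y) ⟩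
      (u′ * x + v′) + (u * y + v)  ≡⟨ solve 6 (λ u u′ x y v v′ → (u′ :* x :+ v′) :+ (u :* y :+ v)
                                                             := u′ :* x :+ u :* y :+ (v :+ v′)) refl u u′ x y v v′ ⟩
      u′ * x + u * y + (v + v′)    ∎))

  pow≗^ : ∀ x n → pow F x n ≡ x ^ n
  pow≗^ x zero    = refl
  pow≗^ x (suc n) = cong (x *_) (pow≗^ x n)

  ^-nonZero : ∀ {x} n → x ≢ 0# → x ^ n ≢ 0#
  ^-nonZero zero    _   = 1≢0
  ^-nonZero (suc n) x≢0 = *-nonZero x≢0 (^-nonZero n x≢0)

  ∈-elements : ∀ x → x ∈ elements F
  ∈-elements x =
    subst (_∈ elements F) (Inverse.strictlyInverseˡ enum x) (∈-map⁺ (Inverse.to enum) (∈-allFin (Inverse.from enum x)))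

  elements-unique : Unique (elements F)
  elements-unique = Unique.map⁺ (Injection.injective (Inverse⇒Injection enum)) (Unique.allFin⁺ q)

  length-elements : length (elements F) ≡ q
  length-elements = trans (length-map (Inverse.to enum) (allFin q)) (length-tabulate id)

  unique⇒length≤q : ∀ {xs} → Unique xs → length xs ≤ q
  unique⇒length≤q xs! = subst (_ ≤_) length-elements (unique-⊆⇒length≤ xs! (λ {x} _ → ∈-elements x))

  2≤q : 2 ≤ q
  2≤q = unique⇒length≤q ((0≢1 ∷ []) ∷ [] ∷ [])

  q∸1≢0 : q ∸ 1 ≢ 0
  q∸1≢0 = ℕ.>⇒≢ (ℕ.m<n⇒0<n∸m 2≤q)

  1+[q∸1]≡q : suc (q ∸ 1) ≡ q
  1+[q∸1]≡q = ℕ.suc-pred q {{ℕ.>-nonZero (≤-trans (s≤s z≤n) 2≤q)}}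

  nonZeros : List Carrier
  nonZeros = filter (∁? (_≟ 0#)) (elements F)

  nonZeros-unique : Unique nonZeros
  nonZeros-unique = Unique.filter⁺ (∁? (_≟ 0#)) elements-unique

  ∈-nonZeros : ∀ {x} → x ≢ 0# → x ∈ nonZeros
  ∈-nonZeros {x} = ∈-filter⁺ (∁? (_≟ 0#)) (∈-elements x)

  ∈-nonZeros⁻ : ∀ {x} → x ∈ nonZeros → x ≢ 0#
  ∈-nonZeros⁻ x∈ = proj₂ (∈-filter⁻ (∁? (_≟ 0#)) {xs = elements F} x∈)

  length-nonZeros : length nonZeros ≡ q ∸ 1
  length-nonZeros = cong (_∸ 1) (trans (length-filter-≢ _≟_ elements-unique (∈-elements 0#)) length-elements)

  product : List Carrier → Carrier
  product = foldr _*_ 1#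

  product-↭ : ∀ {xs ys} → xs ↭ ys → product xs ≡ product ys
  product-↭ xs↭ys = foldr-commMonoid *-isCommutativeMonoid (↭⇒↭ₛ xs↭ys)
    where open import Data.List.Relation.Binary.Permutation.Setoid.Properties (Eq.setoid Carrier) using (foldr-commMonoid)

  product-map-* : ∀ x xs → product (map (x *_) xs) ≡ x ^ length xs * product xs
  product-map-* x []       = sym (*-identityˡ 1#)
  product-map-* x (y ∷ xs) = begin
    x * y * product (map (x *_) xs)   ≡⟨ cong (x * y *_) (product-map-* x xs) ⟩
    x * y * (x ^ length xs * product xs)
      ≡⟨ solve 4 (λ x y xⁿ p → x :* y :* (xⁿ :* p) := x :* xⁿ :* (y :* p)) refl x y (x ^ length xs) (product xs) ⟩
    x * x ^ length xs * (y * product xs) ∎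

  product-nonZero : ∀ {xs} → All (_≢ 0#) xs → product xs ≢ 0#
  product-nonZero []            = 1≢0
  product-nonZero (x≢0 ∷ xs≢0)  = *-nonZero x≢0 (product-nonZero xs≢0)

  -- Multiplication by x permutes the nonzero elements, so x ^ (q ∸ 1) fixes their (nonzero) product.
  fermat : ∀ {x} → x ≢ 0# → x ^ (q ∸ 1) ≡ 1#
  fermat {x} x≢0 = subst (λ n → x ^ n ≡ 1#) length-nonZeros (*-cancelʳ-nonZero P≢0 (begin
    x ^ length nonZeros * product nonZeros   ≡⟨ product-map-* x nonZeros ⟨
    product (map (x *_) nonZeros)            ≡⟨ product-↭ x*-permutes ⟩
    product nonZeros                         ≡⟨ *-identityˡ _ ⟨
    1# * product nonZeros                    ∎))
    where
    P≢0 : product nonZeros ≢ 0#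
    P≢0 = product-nonZero (All.tabulate ∈-nonZeros⁻)
    x*-into : ∀ {z} → z ∈ map (x *_) nonZeros → z ∈ nonZeros
    x*-into z∈ with ∈-map⁻ (x *_) z∈
    ... | y , y∈ , refl = ∈-nonZeros (*-nonZero x≢0 (∈-nonZeros⁻ y∈))
    x*-onto : ∀ {z} → z ∈ nonZeros → z ∈ map (x *_) nonZeros
    x*-onto {z} z∈ = subst (_∈ map (x *_) nonZeros) x[x⁻¹z]≡z
      (∈-map⁺ (x *_) (∈-nonZeros (*-nonZero (⁻¹-nonZero x≢0) (∈-nonZeros⁻ z∈))))
      where
      x[x⁻¹z]≡z : x * (x ⁻¹ * z) ≡ z
      x[x⁻¹z]≡z = trans (sym (*-assoc x (x ⁻¹) z)) (trans (cong (_* z) (x*x⁻¹≡1 x≢0)) (*-identityˡ z))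
    x*-permutes : map (x *_) nonZeros ↭ nonZeros
    x*-permutes = ∼bag⇒↭ (unique∧set⇒bag (Unique.map⁺ (*-cancelˡ-nonZero x≢0) nonZeros-unique) nonZeros-unique
                                          (mk⇔ x*-into x*-onto))

  x^n≡1⇒x^gcd≡1 : ∀ {x} n → x ≢ 0# → x ^ n ≡ 1# → x ^ gcd n (q ∸ 1) ≡ 1#
  x^n≡1⇒x^gcd≡1 n x≢0 x^n≡1 = x^m≈1⇒x^n≈1⇒x^gcd≈1 semiring n (q ∸ 1) x^n≡1 (fermat x≢0)

  -- A list cs of length n stands for the monic polynomial c₀ + c₁ x + ⋯ + cₙ₋₁ xⁿ⁻¹ + xⁿ.
  eval : List Carrier → Carrier → Carrier
  eval []       x = 1#
  eval (c ∷ cs) x = c + x * eval cs x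

  quotient : Carrier → List Carrier → List Carrier
  quotient r []       = []
  quotient r (c ∷ cs) = eval (c ∷ cs) r ∷ quotient r cs

  length-quotient : ∀ r cs → length (quotient r cs) ≡ length cs
  length-quotient r []       = refl
  length-quotient r (c ∷ cs) = cong suc (length-quotient r cs)

  -- p(x) − p(r) = (x − r) · quotient r cs (x)  for  p = c ∷ cs, with the subtractions moved across.
  eval-quotient : ∀ r c cs x →
                  eval (c ∷ cs) x + r * eval (quotient r cs) x ≡ x * eval (quotient r cs) x + eval (c ∷ cs) r
  eval-quotient r c []        x =
    solve 3 (λ r c x → c :+ x :* con 1 :+ r :* con 1 := x :* con 1 :+ (c :+ r :* con 1)) refl r c x
  eval-quotient r c (c′ ∷ cs) x = begin
    c + x * P x + r * (P r + x * Q x)     ≡⟨ solve 6 (λ c x r Px Pr Qx → c :+ x :* Px :+ r :* (Pr :+ x :* Qx)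
                                                    := c :+ r :* Pr :+ x :* (Px :+ r :* Qx)) refl c x r (P x) (P r) (Q x) ⟩
    c + r * P r + x * (P x + r * Q x)     ≡⟨ cong (λ z → c + r * P r + x * z) (eval-quotient r c′ cs x) ⟩
    c + r * P r + x * (x * Q x + P r)     ≡⟨ solve 5 (λ c x r Pr Qx → c :+ r :* Pr :+ x :* (x :* Qx :+ Pr)
                                                    := x :* (Pr :+ x :* Qx) :+ (c :+ r :* Pr)) refl c x r (P r) (Q x) ⟩
    x * (P r + x * Q x) + (c + r * P r)   ∎
    where
    P = eval (c′ ∷ cs)
    Q = eval (quotient r cs)

  roots≤degree : ∀ cs {rs} → Unique rs → All (λ r → eval cs r ≡ 0#) rs → length rs ≤ length cs
  roots≤degree cs       {[]}     _             _                = z≤n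
  roots≤degree []       {r ∷ rs} _             (1≡0 ∷ _)        = contradiction 1≡0 1≢0
  roots≤degree (c ∷ cs) {r ∷ rs} (r∉rs ∷ rs!) (pr≡0 ∷ prs≡0) =
    subst (λ n → suc (length rs) ≤ suc n) (length-quotient r cs)
          (s≤s (roots≤degree (quotient r cs) rs! (All.zipWith quotient-root (r∉rs , prs≡0))))
    where
    quotient-root : ∀ {s} → r ≢ s × eval (c ∷ cs) s ≡ 0# → eval (quotient r cs) s ≡ 0#
    quotient-root {s} (r≢s , ps≡0) with eval (quotient r cs) s ≟ 0#
    ... | yes Qs≡0 = Qs≡0
    ... | no  Qs≢0 = contradiction (*-cancelʳ-nonZero Qs≢0 (begin
      r * Q s                       ≡⟨ +-identityˡ _ ⟨
      0# + r * Q s                  ≡⟨ cong (_+ r * Q s) ps≡0 ⟨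
      eval (c ∷ cs) s + r * Q s     ≡⟨ eval-quotient r c cs s ⟩
      s * Q s + eval (c ∷ cs) r     ≡⟨ cong (s * Q s +_) pr≡0 ⟩
      s * Q s + 0#                  ≡⟨ +-identityʳ _ ⟩
      s * Q s                       ∎)) r≢s
      where Q = eval (quotient r cs)

  eval-zeros++ : ∀ k cs x → eval (replicate k 0# ++ cs) x ≡ x ^ k * eval cs x
  eval-zeros++ zero    cs x = sym (*-identityˡ _)
  eval-zeros++ (suc k) cs x = begin
    0# + x * eval (replicate k 0# ++ cs) x   ≡⟨ +-identityˡ _ ⟩
    x * eval (replicate k 0# ++ cs) x        ≡⟨ cong (x *_) (eval-zeros++ k cs x) ⟩
    x * (x ^ k * eval cs x)                  ≡⟨ *-assoc x (x ^ k) (eval cs x) ⟨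
    x * x ^ k * eval cs x                    ∎

  rootsOfUnity : ℕ → List Carrier
  rootsOfUnity n = filter (λ x → (x ^ n) ≟ 1#) (elements F)

  ∈-rootsOfUnity⁻ : ∀ {n x} → x ∈ rootsOfUnity n → x ^ n ≡ 1#
  ∈-rootsOfUnity⁻ {n} x∈ = proj₂ (∈-filter⁻ (λ x → (x ^ n) ≟ 1#) {xs = elements F} x∈)

  rootsOfUnity-unique : ∀ n → Unique (rootsOfUnity n)
  rootsOfUnity-unique n = Unique.filter⁺ (λ x → (x ^ n) ≟ 1#) elements-unique

  #rootsOfUnity≤ : ∀ {n ys} → 0 < n → Unique ys → All (λ y → y ^ n ≡ 1#) ys → length ys ≤ n
  #rootsOfUnity≤ {suc k} {ys} _ ys! ys^n≡1 =
    subst (length ys ≤_) (cong suc (length-replicate k)) (roots≤degree (- 1# ∷ replicate k 0#) ys! (All.map root ys^n≡1))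
    where
    root : ∀ {y} → y ^ suc k ≡ 1# → - 1# + y * eval (replicate k 0#) y ≡ 0#
    root {y} y^n≡1 = begin
      - 1# + y * eval (replicate k 0#) y         ≡⟨ cong (λ z → - 1# + y * eval z y) (++-identityʳ (replicate k 0#)) ⟨
      - 1# + y * eval (replicate k 0# ++ []) y   ≡⟨ cong (λ z → - 1# + y * z) (trans (eval-zeros++ k [] y) (*-identityʳ _)) ⟩
      - 1# + y ^ suc k                           ≡⟨ cong (- 1# +_) y^n≡1 ⟩
      - 1# + 1#                                  ≡⟨ -‿inverseˡ 1# ⟩
      0#                                         ∎

  0<gcd[n,q∸1] : ∀ n → 0 < gcd n (q ∸ 1)
  0<gcd[n,q∸1] n = ℕ.n≢0⇒n>0 (gcd[m,n]≢0 n (q ∸ 1) (inj₂ q∸1≢0))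

  #equalPowers≤gcd : ∀ n {rs} → Unique rs → All (_≢ 0#) rs → (∀ {r s} → r ∈ rs → s ∈ rs → r ^ n ≡ s ^ n) →
                     length rs ≤ gcd n (q ∸ 1)
  #equalPowers≤gcd n {[]}      _   _                 _        = z≤n
  #equalPowers≤gcd n {r₀ ∷ rs} rs! rs≢0@(r₀≢0 ∷ _) same-power =
    subst (_≤ gcd n (q ∸ 1)) (length-map (_* r₀ ⁻¹) (r₀ ∷ rs))
          (#rootsOfUnity≤ (0<gcd[n,q∸1] n) (Unique.map⁺ (*-cancelʳ-nonZero (⁻¹-nonZero r₀≢0)) rs!)
                          (Allₚ.map⁺ (All.tabulate ratio^gcd≡1)))
    where
    ratio^gcd≡1 : ∀ {r} → r ∈ r₀ ∷ rs → (r * r₀ ⁻¹) ^ gcd n (q ∸ 1) ≡ 1#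
    ratio^gcd≡1 {r} r∈ = x^n≡1⇒x^gcd≡1 n (*-nonZero (All.lookup rs≢0 r∈) (⁻¹-nonZero r₀≢0))
      (*-cancelʳ-nonZero (^-nonZero n r₀≢0) (begin
        (r * r₀ ⁻¹) ^ n * r₀ ^ n   ≡⟨ ^-distrib-* (r * r₀ ⁻¹) r₀ n ⟨
        (r * r₀ ⁻¹ * r₀) ^ n       ≡⟨ cong (_^ n) (x*y⁻¹*y≡x r₀≢0) ⟩
        r ^ n                      ≡⟨ same-power r∈ (here refl) ⟩
        r₀ ^ n                     ≡⟨ *-identityˡ _ ⟨
        1# * r₀ ^ n                ∎))

  rootsOfUnity-⊆ : ∀ {m n} → m ∣ n → rootsOfUnity m ⊆ rootsOfUnity n
  rootsOfUnity-⊆ {m} (divides k refl) {x} x∈ =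
    ∈-filter⁺ (λ x → (x ^ (k ℕ.* m)) ≟ 1#) (∈-elements x) (x^n≈1⇒x^[k*n]≈1 semiring m k (∈-rootsOfUnity⁻ {m} x∈))

  geometric : ℕ → ℕ → List Carrier
  geometric k zero    = []
  geometric k (suc j) = 1# ∷ replicate k 0# ++ geometric k j

  length-geometric : ∀ k j → length (geometric k j) ≡ suc k ℕ.* j
  length-geometric k zero    = sym (ℕ.*-zeroʳ k)
  length-geometric k (suc j) = begin
    suc (length (replicate k 0# ++ geometric k j))            ≡⟨ cong suc (length-++ (replicate k 0#)) ⟩
    suc (length (replicate k 0#) ℕ.+ length (geometric k j))
      ≡⟨ cong₂ (λ a b → suc (a ℕ.+ b)) (length-replicate k) (length-geometric k j) ⟩
    suc (k ℕ.+ suc k ℕ.* j)                                   ≡⟨ ℕ.*-suc (suc k) j ⟨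
    suc k ℕ.* suc j                                           ∎

  -- With X = x ^ suc k this is the polynomial 1 + X + ⋯ + Xʲ, so (X − 1) · eval (geometric k j) x = Xʲ⁺¹ − 1.
  eval-geometric : ∀ k j x → x ^ suc k * eval (geometric k j) x + 1# ≡ eval (geometric k j) x + (x ^ suc k) ^ suc j
  eval-geometric k zero    x = solve 1 (λ X → X :* con 1 :+ con 1 := con 1 :+ X :* con 1) refl (x ^ suc k)
  eval-geometric k (suc j) x = begin
    X * G′ + 1#              ≡⟨ cong (λ z → X * z + 1#) G′≡1+XG ⟩
    X * (1# + X * G) + 1#    ≡⟨ solve 2 (λ X G → X :* (con 1 :+ X :* G) :+ con 1 := con 1 :+ X :* (X :* G :+ con 1)) refl X G ⟩
    1# + X * (X * G + 1#)    ≡⟨ cong (λ z → 1# + X * z) (eval-geometric k j x) ⟩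
    1# + X * (G + Xʲ⁺¹)      ≡⟨ solve 3 (λ X G Y → con 1 :+ X :* (G :+ Y) := con 1 :+ X :* G :+ X :* Y) refl X G Xʲ⁺¹ ⟩
    1# + X * G + X * Xʲ⁺¹    ≡⟨ cong (_+ X * Xʲ⁺¹) G′≡1+XG ⟨
    G′ + X * Xʲ⁺¹            ∎
    where
    X   = x ^ suc k
    G   = eval (geometric k j) x
    G′  = eval (geometric k (suc j)) x
    Xʲ⁺¹ = X ^ suc j
    G′≡1+XG : G′ ≡ 1# + X * G
    G′≡1+XG = cong (1# +_) (trans (cong (x *_) (eval-zeros++ k (geometric k j) x)) (sym (*-assoc x (x ^ k) G)))

  geometric-root : ∀ k j {x} → x ^ suc k ≢ 1# → (x ^ suc k) ^ suc j ≡ 1# → eval (geometric k j) x ≡ 0#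
  geometric-root k j {x} X≢1 Xʲ⁺¹≡1 with eval (geometric k j) x ≟ 0#
  ... | yes G≡0 = G≡0
  ... | no  G≢0 = contradiction (*-cancelʳ-nonZero G≢0 (+-cancelʳ 1# _ _ (begin
    x ^ suc k * G + 1#          ≡⟨ eval-geometric k j x ⟩
    G + (x ^ suc k) ^ suc j     ≡⟨ cong (G +_) Xʲ⁺¹≡1 ⟩
    G + 1#                      ≡⟨ cong (_+ 1#) (*-identityˡ G) ⟨
    1# * G + 1#                 ∎))) X≢1
    where G = eval (geometric k j) x

  divisor≤#rootsOfUnity : ∀ {m} → m ∣ q ∸ 1 → m ≤ length (rootsOfUnity m)
  divisor≤#rootsOfUnity {zero}  _                                = z≤n
  divisor≤#rootsOfUnity {suc k} (divides zero    q∸1≡0)          = contradiction q∸1≡0 q∸1≢0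
  divisor≤#rootsOfUnity {suc k} (divides (suc j) q∸1≡[1+j][1+k]) =
    ℕ.+-cancelʳ-≤ B (suc k) A (subst (_≤ A ℕ.+ B) A+#nonRoots≡suc[k]+B (ℕ.+-monoʳ-≤ A nonRoots≤B))
    where
    A = length (rootsOfUnity (suc k))
    B = suc (suc k ℕ.* j)
    nonRoots = filter (∁? (λ x → (x ^ suc k) ≟ 1#)) (elements F)
    root : ∀ {x} → x ^ suc k ≢ 1# → 0# + x * eval (geometric k j) x ≡ 0#
    root {x} X≢1 with x ≟ 0#
    ... | yes refl = trans (+-identityˡ _) (zeroˡ _)
    ... | no  x≢0  = trans (+-identityˡ _) (trans (cong (x *_) (geometric-root k j X≢1 Xʲ⁺¹≡1)) (zeroʳ x))
      where
      Xʲ⁺¹≡1 : (x ^ suc k) ^ suc j ≡ 1#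
      Xʲ⁺¹≡1 = trans (^-assocʳ x (suc k) (suc j))
                     (subst (λ e → x ^ e ≡ 1#) (trans q∸1≡[1+j][1+k] (ℕ.*-comm (suc j) (suc k))) (fermat x≢0))
    nonRoots≤B : length nonRoots ≤ B
    nonRoots≤B = subst (length nonRoots ≤_) (cong suc (length-geometric k j))
      (roots≤degree (0# ∷ geometric k j) (Unique.filter⁺ _ elements-unique) (All.map root (all-filter _ (elements F))))
    A+#nonRoots≡suc[k]+B : A ℕ.+ length nonRoots ≡ suc k ℕ.+ B
    A+#nonRoots≡suc[k]+B = begin
      A ℕ.+ length nonRoots       ≡⟨ length-filter+length-filter-∁ (λ x → (x ^ suc k) ≟ 1#) (elements F) ⟩
      length (elements F)         ≡⟨ length-elements ⟩
      q                           ≡⟨ 1+[q∸1]≡q ⟨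
      suc (q ∸ 1)                 ≡⟨ cong suc q∸1≡[1+j][1+k] ⟩
      suc (suc k ℕ.+ j ℕ.* suc k) ≡⟨ cong (λ n → suc (suc k ℕ.+ n)) (ℕ.*-comm j (suc k)) ⟩
      suc (suc k ℕ.+ suc k ℕ.* j) ≡⟨ ℕ.+-suc (suc k) (suc k ℕ.* j) ⟨
      suc k ℕ.+ B                 ∎

  gcd≤#rootsOfUnity : ∀ n → gcd n (q ∸ 1) ≤ length (rootsOfUnity n)
  gcd≤#rootsOfUnity n = ≤-trans (divisor≤#rootsOfUnity (gcd[m,n]∣n n (q ∸ 1)))
    (unique-⊆⇒length≤ (rootsOfUnity-unique (gcd n (q ∸ 1))) (rootsOfUnity-⊆ (gcd[m,n]∣m n (q ∸ 1))))

  ScalingRigid : List Carrier → Set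
  ScalingRigid R = ∀ {t x₁ x₂} → x₁ ≢ x₂ → x₁ ∈ R → x₂ ∈ R → t * x₁ ∈ R → t * x₂ ∈ R → t ≡ 1#

  module Ratios {R : List Carrier} (R! : Unique R) (R≢0 : All (_≢ 0#) R) where

    others : Carrier → List Carrier
    others x = filter (∁? (_≟ x)) R

    ratios : Carrier → List Carrier
    ratios x = map (_* x ⁻¹) (others x)

    ∈-others⁻ : ∀ {x y} → y ∈ others x → y ∈ R × y ≢ x
    ∈-others⁻ {x} = ∈-filter⁻ (∁? (_≟ x)) {xs = R}

    n∸1≤#ratios : ∀ {x} → x ∈ R → length R ∸ 1 ≤ length (ratios x)
    n∸1≤#ratios {x} x∈R = ℕ.≤-reflexive (begin
      length R ∸ 1        ≡⟨ cong (_∸ 1) (length-filter-≢ _≟_ R! x∈R) ⟨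
      length (others x)   ≡⟨ length-map (_* x ⁻¹) (others x) ⟨
      length (ratios x)   ∎)

    ratios-unique : ∀ {x} → x ∈ R → Unique (ratios x)
    ratios-unique x∈R = Unique.map⁺ (*-cancelʳ-nonZero (⁻¹-nonZero (All.lookup R≢0 x∈R))) (Unique.filter⁺ _ R!)

    ratio≢0,1 : ∀ {z} → z ∈ concatMap ratios R → z ≢ 0# × z ≢ 1#
    ratio≢0,1 z∈ with find (∈-concatMap⁻ ratios z∈)
    ... | x₁ , x₁∈R , z∈ratios with ∈-map⁻ (_* x₁ ⁻¹) z∈ratios
    ... | x₂ , x₂∈ , refl =
      *-nonZero (All.lookup R≢0 (proj₁ (∈-others⁻ x₂∈))) (⁻¹-nonZero x₁≢0) ,
      λ x₂/x₁≡1 → proj₂ (∈-others⁻ x₂∈)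
                    (trans (sym (x*y⁻¹*y≡x x₁≢0)) (trans (cong (_* x₁) x₂/x₁≡1) (*-identityˡ x₁)))
      where x₁≢0 = All.lookup R≢0 x₁∈R

    -- If x₂ / x₁ = y₂ / y₁, then t = y₁ / x₁ maps x₁, x₂ to y₁, y₂.
    ratios-disjoint : ScalingRigid R →
                      ∀ {x₁ y₁ z} → x₁ ∈ R → y₁ ∈ R → z ∈ ratios x₁ → z ∈ ratios y₁ → x₁ ≡ y₁
    ratios-disjoint rigid {x₁} {y₁} x₁∈R y₁∈R z∈ z∈′
      with ∈-map⁻ (_* x₁ ⁻¹) z∈ | ∈-map⁻ (_* y₁ ⁻¹) z∈′
    ... | x₂ , x₂∈ , refl | y₂ , y₂∈ , x₂/x₁≡y₂/y₁ = begin
      x₁         ≡⟨ *-identityˡ x₁ ⟨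
      1# * x₁    ≡⟨ cong (_* x₁) t≡1 ⟨
      t * x₁     ≡⟨ tx₁≡y₁ ⟩
      y₁         ∎
      where
      t = y₁ * x₁ ⁻¹
      tx₁≡y₁ : t * x₁ ≡ y₁
      tx₁≡y₁ = x*y⁻¹*y≡x (All.lookup R≢0 x₁∈R)
      tx₂≡y₂ : t * x₂ ≡ y₂
      tx₂≡y₂ = begin
        y₁ * x₁ ⁻¹ * x₂     ≡⟨ solve 3 (λ y₁ x₁⁻ x₂ → y₁ :* x₁⁻ :* x₂ := y₁ :* (x₂ :* x₁⁻))
                                       refl y₁ (x₁ ⁻¹) x₂ ⟩
        y₁ * (x₂ * x₁ ⁻¹)   ≡⟨ cong (y₁ *_) x₂/x₁≡y₂/y₁ ⟩
        y₁ * (y₂ * y₁ ⁻¹)   ≡⟨ solve 3 (λ y₁ y₂ y₁⁻ → y₁ :* (y₂ :* y₁⁻) := y₂ :* y₁⁻ :* y₁)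
                                       refl y₁ y₂ (y₁ ⁻¹) ⟩
        y₂ * y₁ ⁻¹ * y₁     ≡⟨ x*y⁻¹*y≡x (All.lookup R≢0 y₁∈R) ⟩
        y₂                  ∎
      t≡1 : t ≡ 1#
      t≡1 = rigid (λ x₁≡x₂ → proj₂ (∈-others⁻ x₂∈) (sym x₁≡x₂)) x₁∈R (proj₁ (∈-others⁻ x₂∈))
                  (subst (_∈ R) (sym tx₁≡y₁) y₁∈R) (subst (_∈ R) (sym tx₂≡y₂) (proj₁ (∈-others⁻ y₂∈)))

  scalingRigid⇒2+n[n∸1]≤q : ∀ {R} → Unique R → All (_≢ 0#) R → ScalingRigid R →
                            2 ℕ.+ length R ℕ.* (length R ∸ 1) ≤ q
  scalingRigid⇒2+n[n∸1]≤q {R} R! R≢0 rigid =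
    ≤-trans (ℕ.+-monoʳ-≤ 2 (length-concatMap≥ ratios (All.tabulate n∸1≤#ratios))) (unique⇒length≤q 0∷1∷ratios!)
    where
    open Ratios R! R≢0
    0∷1∷ratios! : Unique (0# ∷ 1# ∷ concatMap ratios R)
    0∷1∷ratios! = (0≢1 ∷ All.tabulate (λ z∈ 0≡z → proj₁ (ratio≢0,1 z∈) (sym 0≡z)))
                ∷ All.tabulate (λ z∈ 1≡z → proj₂ (ratio≢0,1 z∈) (sym 1≡z))
                ∷ concatMap-unique ratios R! ratios-unique (ratios-disjoint rigid)

module PlaneProperties {q : ℕ} (F : FiniteField q) where
  open FiniteField F
  open FiniteFieldProperties F

  origin : Triple F
  origin = 0# , 0# , 0#

  triples : List (Triple F)
  triples = concatMap (λ a → concatMap (λ b → map (λ c → (a , b , c)) (elements F)) (elements F)) (elements F)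

  ∈-lineCoords⁺ : ∀ {ℓ} → ℓ ≢ origin → ℓ ∈ lineCoords F
  ∈-lineCoords⁺ {a , b , c} ℓ≢origin = ∈-filter⁺ (λ t → ¬? (_≟T_ F t origin)) ℓ∈triples ℓ≢origin
    where
    ℓ∈triples : (a , b , c) ∈ triples
    ℓ∈triples = ∈-concatMap⁺ _ (lose (∈-elements a)
                  (∈-concatMap⁺ _ (lose (∈-elements b) (∈-map⁺ (λ c → a , b , c) (∈-elements c)))))

  ∈-lineCoords⁻ : ∀ {ℓ} → ℓ ∈ lineCoords F → ℓ ≢ origin
  ∈-lineCoords⁻ ℓ∈ = proj₂ (∈-filter⁻ (λ t → ¬? (_≟T_ F t origin)) {xs = triples} ℓ∈)

  deg≤ : ∀ D {m} → (∀ ℓ → ℓ ≢ origin → onLine F D ℓ ≤ m) → deg F D ≤ m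
  deg≤ D bound = maxList-≤ (Allₚ.map⁺ (All.tabulate (λ {ℓ} ℓ∈ → bound ℓ (∈-lineCoords⁻ ℓ∈))))

  onLine≤deg : ∀ D ℓ → ℓ ≢ origin → onLine F D ℓ ≤ deg F D
  onLine≤deg D ℓ ℓ≢origin = ≤-maxList (∈-map⁺ (onLine F D) (∈-lineCoords⁺ ℓ≢origin))

  module Graph (f : Carrier → Carrier) where

    affineMeet : Triple F → List Carrier
    affineMeet ℓ = filter (λ x → incident? F ℓ (x , f x , 1#)) (elements F)

    affineMeet-unique : ∀ ℓ → Unique (affineMeet ℓ)
    affineMeet-unique ℓ = Unique.filter⁺ (λ x → incident? F ℓ (x , f x , 1#)) elements-unique

    ∈-affineMeet⁻ : ∀ {a b c x} → x ∈ affineMeet (a , b , c) → a * x + b * f x + c ≡ 0#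
    ∈-affineMeet⁻ {a} {b} {c} {x} x∈ =
      trans (cong (a * x + b * f x +_) (sym (*-identityʳ c)))
            (proj₂ (∈-filter⁻ (λ x → incident? F (a , b , c) (x , f x , 1#)) {xs = elements F} x∈))

    ∈-affineMeet⁺ : ∀ {a b c x} → a * x + b * f x + c ≡ 0# → x ∈ affineMeet (a , b , c)
    ∈-affineMeet⁺ {a} {b} {c} {x} on-ℓ =
      ∈-filter⁺ (λ x → incident? F (a , b , c) (x , f x , 1#)) (∈-elements x)
                (trans (cong (a * x + b * f x +_) (*-identityʳ c)) on-ℓ)

    affinePoints : List (Triple F)
    affinePoints = map (λ x → x , f x , 1#) (elements F)

    length-affineMeet : ∀ ℓ → length (affineMeet ℓ) ≡ onLine F affinePoints ℓ
    length-affineMeet ℓ = sym (length-filter-map (incident? F ℓ) (λ x → x , f x , 1#) (elements F))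

    onLine≤1+#affineMeet : ∀ ℓ → onLine F (S F f) ℓ ≤ suc (length (affineMeet ℓ))
    onLine≤1+#affineMeet ℓ with incident? F ℓ (0# , 1# , 0#)
    ... | yes _ = s≤s (ℕ.≤-reflexive (sym (length-affineMeet ℓ)))
    ... | no  _ = ℕ.m≤n⇒m≤1+n (ℕ.≤-reflexive (sym (length-affineMeet ℓ)))

    #affineMeet≤onLine : ∀ ℓ → length (affineMeet ℓ) ≤ onLine F (S F f) ℓ
    #affineMeet≤onLine ℓ with incident? F ℓ (0# , 1# , 0#)
    ... | yes _ = ℕ.m≤n⇒m≤1+n (ℕ.≤-reflexive (length-affineMeet ℓ))
    ... | no  _ = ℕ.≤-reflexive (length-affineMeet ℓ)

    onLine≡#affineMeet : ∀ {a b c} → b ≢ 0# → onLine F (S F f) (a , b , c) ≡ length (affineMeet (a , b , c))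
    onLine≡#affineMeet {a} {b} {c} b≢0 with incident? F (a , b , c) (0# , 1# , 0#)
    ... | yes at-∞ = contradiction (trans (sym form≡b) at-∞) b≢0
      where
      form≡b : a * 0# + b * 1# + c * 0# ≡ b
      form≡b = solve 3 (λ a b c → a :* con 0 :+ b :* con 1 :+ c :* con 0 := b) refl a b c
        where open import Algebra.Solver.Ring.NaturalCoefficients.Default commutativeSemiring using (solve; _:=_; _:+_; _:*_; con)
    ... | no  _    = sym (length-affineMeet (a , b , c))

    onLine-vertical≤2 : ∀ {a c} → (a , 0# , c) ≢ origin → onLine F (S F f) (a , 0# , c) ≤ 2
    onLine-vertical≤2 {a} {c} ℓ≢origin =
      ≤-trans (onLine≤1+#affineMeet (a , 0# , c)) (s≤s (unique-allEqual⇒length≤1 (affineMeet-unique _) allEqual))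
      where
      on-ℓ : ∀ {x} → x ∈ affineMeet (a , 0# , c) → a * x + c ≡ 0#
      on-ℓ {x} x∈ = trans (cong (_+ c) (sym (+-identityʳ (a * x))))
                          (trans (cong (λ z → a * x + z + c) (sym (zeroˡ (f x)))) (∈-affineMeet⁻ x∈))
      allEqual : ∀ {x y} → x ∈ affineMeet (a , 0# , c) → y ∈ affineMeet (a , 0# , c) → x ≡ y
      allEqual x∈ y∈ with a ≟ 0#
      ... | yes refl = contradiction (cong (λ z → 0# , 0# , z) c≡0) ℓ≢origin
        where c≡0 = trans (sym (+-identityˡ c)) (trans (cong (_+ c) (sym (zeroˡ _))) (on-ℓ x∈))
      ... | no  a≢0  = *-cancelˡ-nonZero a≢0 (+-cancelʳ c _ _ (trans (on-ℓ x∈) (sym (on-ℓ y∈))))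

module MonomialGraph {q : ℕ} (F : FiniteField q) (e : ℕ) where
  open FiniteField F
  open FiniteFieldProperties F
  open PlaneProperties F
  open import Algebra.Solver.Ring.NaturalCoefficients.Default commutativeSemiring using (solve; _:=_; _:+_; _:*_; con)
  open ≡-Reasoning

  d : ℕ
  d = 2 ℕ.+ e

  open Graph (λ x → pow F x d)

  S[xᵈ] : List (Triple F)
  S[xᵈ] = S F (λ x → pow F x d)

  roots : Carrier → Carrier → Carrier → List Carrier
  roots a b c = affineMeet (a , b , c)

  ∈-roots⁻ : ∀ {a b c x} → x ∈ roots a b c → a * x + b * x ^ d + c ≡ 0#
  ∈-roots⁻ {a} {b} {c} {x} x∈ = trans (cong (λ z → a * x + b * z + c) (sym (pow≗^ x d))) (∈-affineMeet⁻ x∈)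

  ∈-roots⁺ : ∀ {a b c x} → a * x + b * x ^ d + c ≡ 0# → x ∈ roots a b c
  ∈-roots⁺ {a} {b} {c} {x} on-ℓ = ∈-affineMeet⁺ (trans (cong (λ z → a * x + b * z + c) (pow≗^ x d)) on-ℓ)

  root≢0 : ∀ {a b c x} → c ≢ 0# → x ∈ roots a b c → x ≢ 0#
  root≢0 {a} {b} {c} c≢0 x∈ refl = c≢0 (trans (sym E[0]≡c) (∈-roots⁻ x∈))
    where
    E[0]≡c : a * 0# + b * 0# ^ d + c ≡ c
    E[0]≡c = solve 4 (λ a b c P → a :* con 0 :+ b :* (con 0 :* P) :+ c := c) refl a b c (0# ^ suc e)

  -- T = t ^ d: this is T · E(x) − E(t x) = 0 for E(x) = a x + b x ^ d + c, with the subtractions moved across.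
  scaled-root : ∀ {a b c t x} → x ∈ roots a b c → t * x ∈ roots a b c → a * t ^ d * x + c * t ^ d ≡ a * t * x + c
  scaled-root {a} {b} {c} {t} {x} x∈ tx∈ = begin
    a * T * x + c * T                                    ≡⟨ +-identityˡ _ ⟨
    0# + (a * T * x + c * T)                             ≡⟨ cong (_+ (a * T * x + c * T)) (∈-roots⁻ tx∈) ⟨
    a * (t * x) + b * (t * x) ^ d + c + (a * T * x + c * T)
      ≡⟨ cong (λ z → a * (t * x) + b * z + c + (a * T * x + c * T)) (^-distrib-* t x d) ⟩
    a * (t * x) + b * (T * x ^ d) + c + (a * T * x + c * T)
      ≡⟨ identity a b c t x T (x ^ d) ⟩
    T * (a * x + b * x ^ d + c) + (a * t * x + c)       ≡⟨ cong (λ z → T * z + (a * t * x + c)) (∈-roots⁻ x∈) ⟩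
    T * 0# + (a * t * x + c)                             ≡⟨ cong (_+ (a * t * x + c)) (zeroʳ T) ⟩
    0# + (a * t * x + c)                                 ≡⟨ +-identityˡ _ ⟩
    a * t * x + c                                        ∎
    where
    T = t ^ d
    identity : ∀ a b c t x T P →
               a * (t * x) + b * (T * P) + c + (a * T * x + c * T) ≡ T * (a * x + b * P + c) + (a * t * x + c)
    identity = solve 7 (λ a b c t x T P → a :* (t :* x) :+ b :* (T :* P) :+ c :+ (a :* T :* x :+ c :* T)
                                      := T :* (a :* x :+ b :* P :+ c) :+ (a :* t :* x :+ c)) refl

  roots-scalingRigid : ∀ {a b c} → a ≢ 0# → c ≢ 0# → ScalingRigid (roots a b c)
  roots-scalingRigid {a} {b} {c} a≢0 c≢0 {t} x₁≢x₂ x₁∈ x₂∈ tx₁∈ tx₂∈ = trans (sym tᵈ≡t) tᵈ≡1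
    where
    agree : a * t ^ d ≡ a * t × c * t ^ d ≡ c
    agree = affine-agree x₁≢x₂ (scaled-root x₁∈ tx₁∈) (scaled-root x₂∈ tx₂∈)
    tᵈ≡t : t ^ d ≡ t
    tᵈ≡t = *-cancelˡ-nonZero a≢0 (proj₁ agree)
    tᵈ≡1 : t ^ d ≡ 1#
    tᵈ≡1 = *-cancelˡ-nonZero c≢0 (trans (proj₂ agree) (sym (*-identityʳ c)))

  #roots≤floorHalfPlusSqrt : ∀ {a b c} → a ≢ 0# → c ≢ 0# → length (roots a b c) ≤ floorHalfPlusSqrt (q ∸ 1)
  #roots≤floorHalfPlusSqrt {a} {b} {c} a≢0 c≢0 = n*[n∸1]<m⇒n≤floorHalfPlusSqrt _ (q ∸ 1) (ℕ.∸-monoˡ-≤ 1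
    (scalingRigid⇒2+n[n∸1]≤q (affineMeet-unique _) (All.tabulate (root≢0 c≢0)) (roots-scalingRigid a≢0 c≢0)))

  #roots[0,b,c]≤gcd : ∀ {b c} → b ≢ 0# → c ≢ 0# → length (roots 0# b c) ≤ gcd d (q ∸ 1)
  #roots[0,b,c]≤gcd {b} {c} b≢0 c≢0 = #equalPowers≤gcd d (affineMeet-unique _) (All.tabulate (root≢0 c≢0)) equal-powers
    where
    on-curve : ∀ {x} → x ∈ roots 0# b c → b * x ^ d + c ≡ 0#
    on-curve {x} x∈ = trans (cong (_+ c) (sym (+-identityˡ _)))
                            (trans (cong (λ z → z + b * x ^ d + c) (sym (zeroˡ x))) (∈-roots⁻ x∈))
    equal-powers : ∀ {x y} → x ∈ roots 0# b c → y ∈ roots 0# b c → x ^ d ≡ y ^ d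
    equal-powers x∈ y∈ = *-cancelˡ-nonZero b≢0 (+-cancelʳ c _ _ (trans (on-curve x∈) (sym (on-curve y∈))))

  #roots[a,b,0]≤1+gcd : ∀ {a b} → b ≢ 0# → length (roots a b 0#) ≤ suc (gcd (suc e) (q ∸ 1))
  #roots[a,b,0]≤1+gcd {a} {b} b≢0 = ≤-trans (unique-⊆⇒length≤ (affineMeet-unique _) roots⊆0∷nonZeroRoots)
    (s≤s (#equalPowers≤gcd (suc e) (Unique.filter⁺ _ (affineMeet-unique _)) (all-filter _ (roots a b 0#)) equal-powers))
    where
    nonZeroRoots = filter (∁? (_≟ 0#)) (roots a b 0#)
    roots⊆0∷nonZeroRoots : roots a b 0# ⊆ 0# ∷ nonZeroRoots
    roots⊆0∷nonZeroRoots {x} x∈ with x ≟ 0#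
    ... | yes refl = here refl
    ... | no  x≢0  = there (∈-filter⁺ (∁? (_≟ 0#)) x∈ x≢0)
    on-curve : ∀ {x} → x ∈ nonZeroRoots → a + b * x ^ suc e ≡ 0#
    on-curve {x} x∈ with ∈-filter⁻ (∁? (_≟ 0#)) {xs = roots a b 0#} x∈
    ... | x∈roots , x≢0 = x*y≡0⇒y≡0 x≢0 (trans
      (solve 4 (λ a b x P → x :* (a :+ b :* P) := a :* x :+ b :* (x :* P) :+ con 0) refl a b x (x ^ suc e)) (∈-roots⁻ x∈roots))
    equal-powers : ∀ {x y} → x ∈ nonZeroRoots → y ∈ nonZeroRoots → x ^ suc e ≡ y ^ suc e
    equal-powers x∈ y∈ = *-cancelˡ-nonZero b≢0 (+-cancelˡ a _ _ (trans (on-curve x∈) (sym (on-curve y∈))))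

  bound : ℕ
  bound = (gcd d (q ∸ 1) ⊔ suc (gcd (suc e) (q ∸ 1))) ⊔ floorHalfPlusSqrt (q ∸ 1)

  gcd≤bound : gcd d (q ∸ 1) ≤ bound
  gcd≤bound = m≤n⇒m≤n⊔o (floorHalfPlusSqrt (q ∸ 1)) (ℕ.m≤m⊔n (gcd d (q ∸ 1)) (suc (gcd (suc e) (q ∸ 1))))

  1+gcd≤bound : suc (gcd (suc e) (q ∸ 1)) ≤ bound
  1+gcd≤bound = m≤n⇒m≤n⊔o (floorHalfPlusSqrt (q ∸ 1)) (ℕ.m≤n⊔m (gcd d (q ∸ 1)) (suc (gcd (suc e) (q ∸ 1))))

  floorHalfPlusSqrt≤bound : floorHalfPlusSqrt (q ∸ 1) ≤ bound
  floorHalfPlusSqrt≤bound = ℕ.m≤n⊔m (gcd d (q ∸ 1) ⊔ suc (gcd (suc e) (q ∸ 1))) (floorHalfPlusSqrt (q ∸ 1))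

  #roots≤bound : ∀ a {b} c → b ≢ 0# → length (roots a b c) ≤ bound
  #roots≤bound a c b≢0 with c ≟ 0# | a ≟ 0#
  ... | yes refl | _        = ≤-trans (#roots[a,b,0]≤1+gcd b≢0) 1+gcd≤bound
  ... | no  c≢0  | yes refl = ≤-trans (#roots[0,b,c]≤gcd b≢0 c≢0) gcd≤bound
  ... | no  c≢0  | no  a≢0  = ≤-trans (#roots≤floorHalfPlusSqrt a≢0 c≢0) floorHalfPlusSqrt≤bound

  onLine≤bound : ∀ ℓ → ℓ ≢ origin → onLine F S[xᵈ] ℓ ≤ bound
  onLine≤bound (a , b , c) ℓ≢origin with b ≟ 0#
  ... | yes refl = ≤-trans (onLine-vertical≤2 ℓ≢origin) (≤-trans (s≤s (0<gcd[n,q∸1] (suc e))) 1+gcd≤bound)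
  ... | no  b≢0  = ≤-trans (ℕ.≤-reflexive (onLine≡#affineMeet b≢0)) (#roots≤bound a c b≢0)

  deg≤bound : deg F S[xᵈ] ≤ bound
  deg≤bound = deg≤ S[xᵈ] onLine≤bound

  #roots[a,1,c]≤deg : ∀ a c → length (roots a 1# c) ≤ deg F S[xᵈ]
  #roots[a,1,c]≤deg a c = ≤-trans (#affineMeet≤onLine (a , 1# , c))
    (onLine≤deg S[xᵈ] (a , 1# , c) (λ ℓ≡origin → 1≢0 (cong (proj₁ ∘ proj₂) ℓ≡origin)))

  gcd≤deg : gcd d (q ∸ 1) ≤ deg F S[xᵈ]
  gcd≤deg = ≤-trans (gcd≤#rootsOfUnity d)
    (≤-trans (unique-⊆⇒length≤ (rootsOfUnity-unique d) rootsOfUnity⊆roots) (#roots[a,1,c]≤deg 0# (- 1#)))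
    where
    rootsOfUnity⊆roots : rootsOfUnity d ⊆ roots 0# 1# (- 1#)
    rootsOfUnity⊆roots {x} x∈ = ∈-roots⁺ (begin
      0# * x + 1# * x ^ d + - 1#
        ≡⟨ cong₂ (λ u v → u + v + - 1#) (zeroˡ x) (trans (*-identityˡ _) (∈-rootsOfUnity⁻ {d} x∈)) ⟩
      0# + 1# + - 1#               ≡⟨ cong (_+ - 1#) (+-identityˡ 1#) ⟩
      1# + - 1#                    ≡⟨ -‿inverseʳ 1# ⟩
      0#                           ∎)

  1+gcd≤deg : suc (gcd (suc e) (q ∸ 1)) ≤ deg F S[xᵈ]
  1+gcd≤deg = ≤-trans (s≤s (gcd≤#rootsOfUnity (suc e)))
    (≤-trans (unique-⊆⇒length≤ 0∷rootsOfUnity! 0∷rootsOfUnity⊆roots) (#roots[a,1,c]≤deg (- 1#) 0#))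
    where
    0∷rootsOfUnity! : Unique (0# ∷ rootsOfUnity (suc e))
    0∷rootsOfUnity! =
      All.tabulate (λ x∈ 0≡x → 0≢1 (trans (sym (zeroˡ _)) (trans (cong (_^ suc e) 0≡x) (∈-rootsOfUnity⁻ {suc e} x∈))))
      ∷ rootsOfUnity-unique (suc e)
    0∷rootsOfUnity⊆roots : 0# ∷ rootsOfUnity (suc e) ⊆ roots (- 1#) 1# 0#
    0∷rootsOfUnity⊆roots (here refl) = ∈-roots⁺
      (solve 2 (λ m P → m :* con 0 :+ con 1 :* (con 0 :* P) :+ con 0 := con 0) refl (- 1#) (0# ^ suc e))
    0∷rootsOfUnity⊆roots {x} (there x∈) = ∈-roots⁺ (begin
      - 1# * x + 1# * (x * x ^ suc e) + 0#   ≡⟨ cong (λ z → - 1# * x + 1# * (x * z) + 0#) (∈-rootsOfUnity⁻ {suc e} x∈) ⟩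
      - 1# * x + 1# * (x * 1#) + 0#
        ≡⟨ solve 2 (λ m x → m :* x :+ con 1 :* (x :* con 1) :+ con 0 := (m :+ con 1) :* x) refl (- 1#) x ⟩
      (- 1# + 1#) * x                        ≡⟨ cong (_* x) (-‿inverseˡ 1#) ⟩
      0# * x                                 ≡⟨ zeroˡ x ⟩
      0#                                     ∎)

theorem3p24 : (q : ℕ) (F : FiniteField q) (d : ℕ) → 2 ≤ d →
    (deg F (S F (λ x → pow F x d))
       ≤ (gcd d (q ∸ 1) ⊔ suc (gcd (d ∸ 1) (q ∸ 1))) ⊔ floorHalfPlusSqrt (q ∸ 1))
    × (floorHalfPlusSqrt (q ∸ 1) ≤ gcd d (q ∸ 1) ⊔ suc (gcd (d ∸ 1) (q ∸ 1)) →
       deg F (S F (λ x → pow F x d)) ≡ gcd d (q ∸ 1) ⊔ suc (gcd (d ∸ 1) (q ∸ 1)))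
theorem3p24 q F zero          ()
theorem3p24 q F (suc zero)    (s≤s ())
theorem3p24 q F (suc (suc e)) _ = deg≤bound , λ floor≤max →
  ℕ.≤-antisym (≤-trans deg≤bound (⊔-lub ≤-refl floor≤max)) (⊔-lub gcd≤deg 1+gcd≤deg)
  where open MonomialGraph F e
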